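{- For every integer $n\ge0$, the set of plane-oriented increasing trees of size $n+1$ is in bijection with the set of path diagrams of length $n$ built on the infinite family of step vectors $a_\ell=(1,\ell)$ ($\ell\in\mathbb{N}=\{1,2,\dots\}$), $b=(1,-1)$, $c=(1,0)$, with possibility function $\mathrm{pos}(a_{j,\ell})=j+1$ for all $\ell\in\mathbb{N}$, $\mathrm{pos}(b_j)=j+1$, $\mathrm{pos}(c_j)=j+1$, for all $j\ge0$.
   Context: A plane-oriented increasing tree of size $m$ is a rooted plane (ordered) tree on the nodes $\{1,\dots,m\}$, with arbitrary outdegrees and children ordered left to right, whose labels increase along every path from the root. A word $u=u_1\cdots u_n$ over $\{a_\ell:\ell\in\mathbb{N}\}\cup\{b,c\}$ determines points $M_0=(0,0)$, $M_j=M_{j-1}+u_j$; only paths whose points all have nonnegative $y$-coordinate and with $M_n$ at height $0$ are considered. With $y_j$ the height of $M_j$, the labelled path $\lambda(u)=v_1\cdots v_n$ has $v_j=a_{y_{j-1},\ell}$ if $u_j=a_\ell$, $v_j=b_{y_{j-1}}$ if $u_j=b$, $v_j=c_{y_{j-1}}$ if $u_j=c$. A path diagram of length $n$ is a pair $(\lambda(u),s)$ with $s=s_1\cdots s_n$ integers satisfying $0\le s_j<\mathrm{pos}(v_j)$. -}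

module Defs where

open import Data.Nat using (ℕ; zero; suc; _+_; _<_)
open import Data.Nat.Properties using (≤-decTotalOrder)
open import Data.List using (List; []; _∷_; _++_; length; applyUpTo)
open import Data.List.Relation.Unary.All using (All)
open import Data.Maybe using (Maybe; just; nothing)
open import Data.Fin using (Fin)
open import Data.Product using (Σ; _×_)
open import Relation.Binary.PropositionalEquality using (_≡_)
import Data.List.Sort as Sort

data PTree : Set where
  node : ℕ → List PTree → PTree

label : PTree → ℕ
label (node k _) = k

mutual
  labels : PTree → List ℕ
  labels (node k ts) = k ∷ labelsList ts

  labelsList : List PTree → List ℕ
  labelsList []       = []
  labelsList (t ∷ ts) = labels t ++ labelsList ts

data Increasing : PTree → Set where
  incr : ∀ {k ts} →
         All (λ t → (k < label t) × Increasing t) ts →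
         Increasing (node k ts)

open Sort ≤-decTotalOrder using (sort)

-- the node set is exactly {1,…,m}: the sorted list of labels is [1,…,m]
-- (so each of 1..m occurs exactly once, and nothing else occurs)
LabelSetIs : ℕ → PTree → Set
LabelSetIs m t = sort (labels t) ≡ applyUpTo suc m

IncTree : ℕ → Set
IncTree m = Σ PTree (λ t → Increasing t × LabelSetIs m t)

-- Steps: a ℓ stands for a_{ℓ+1} = (1, ℓ+1), i.e. ℓ ranges over ℕ = {1,2,…}
-- shifted by one; b = (1,-1); c = (1,0).
data Step : Set where
  a : ℕ → Step
  b : Step
  c : Step

step : ℕ → Step → Maybe ℕ
step y (a ℓ)   = just (y + suc ℓ)
step zero b    = nothing
step (suc y) b = just y
step y c       = just y

walk : ℕ → List Step → Maybe ℕ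
walk y []       = just y
walk y (s ∷ u) with step y s
... | nothing = nothing
... | just y' = walk y' u

-- admissible words: all points have nonnegative height, and end at height 0
Valid : List Step → Set
Valid u = walk 0 u ≡ just 0

-- labelled steps: aL j ℓ = a_{j,ℓ+1}, bL j = b_j, cL j = c_j
data LStep : Set where
  aL : ℕ → ℕ → LStep
  bL : ℕ → LStep
  cL : ℕ → LStep

-- labelling λ(u), starting at height y (heights for invalid words are
-- irrelevant, since only valid words are used)
labelFrom : ℕ → List Step → List LStep
labelFrom y []          = []
labelFrom y (a ℓ ∷ u)   = aL y ℓ ∷ labelFrom (y + suc ℓ) u
labelFrom zero (b ∷ u)  = bL zero ∷ labelFrom zero u
labelFrom (suc y) (b ∷ u) = bL (suc y) ∷ labelFrom y u
labelFrom y (c ∷ u)     = cL y ∷ labelFrom y u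

labelPath : List Step → List LStep
labelPath = labelFrom 0

pos : LStep → ℕ
pos (aL j ℓ) = suc j
pos (bL j)   = suc j
pos (cL j)   = suc j

PathDiagram : ℕ → Set
PathDiagram n =
  Σ (List Step) (λ u →
    (length u ≡ n) × Valid u × All (λ v → Fin (pos v)) (labelPath u))

module Submission where

-- Both sides are put in bijection with a common combinatorial object, a
-- Code q k: a sequence of k moves starting from q "slots", where each move
-- picks a slot i among the y+1 current ones and replaces it by d new slots,
-- and the last move leaves exactly one slot.
--
-- * Path side: a path diagram started at height h is a code with h+1 slots;
--   the step a_{ℓ+1}, c, b is the move with d = ℓ+2, 1, 0, and the entry
--   s_j < height+1 is the chosen slot.
-- * Tree side: a forest of q increasing trees carrying the labels
--   j, j+1, …, j+k is decoded by removing the smallest label j.  That label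
--   is a root (labels increase downwards); removing it splices its d children
--   into the list of trees at its position i.  This is a bijection onto
--   forests with labels j+1, …, j+k (removeMin↔), and iterating it gives
--   forests ↔ codes (forest↔code).
-- * A tree of size n+1 is a forest consisting of one tree with labels 1..n+1.

open import Defs
open import Data.Nat
open import Data.Nat.Properties
open import Data.List using (List; []; _∷_; _++_; length; take; drop; applyUpTo)
open import Data.List.Properties using (∷-injectiveˡ; ∷-injectiveʳ; ++-assoc; ++-identityʳ; length-++; length-take; length-drop; take++drop≡id; ≡-dec)
open import Data.List.Relation.Unary.All using (All; []; _∷_)
import Data.List.Relation.Unary.All as All
import Data.List.Relation.Unary.All.Properties as All
open import Data.List.Relation.Unary.Any using (here; there)
open import Data.List.Membership.Propositional using (_∈_)
open import Data.List.Membership.Propositional.Properties using (∈-++⁻)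
open import Data.List.Relation.Binary.Permutation.Propositional using (_↭_; ↭-sym; ↭-trans; ↭-refl; ↭⇒↭ₛ; ↭-prep; ↭-reflexive)
open import Data.List.Relation.Binary.Permutation.Propositional.Properties using (All-resp-↭; ∈-resp-↭; ↭-length; ↭-singleton-inv; shift; drop-∷)
open import Data.List.Relation.Unary.Sorted.TotalOrder ≤-totalOrder using (Sorted)
import Data.List.Relation.Unary.Sorted.TotalOrder.Properties as Sorted
open import Data.List.Relation.Unary.Linked using ([]; [-]; _∷_)
open import Data.List.Relation.Binary.Pointwise using (Pointwise-≡⇒≡)
open import Data.Fin using (Fin; toℕ; fromℕ<)
open import Data.Fin.Properties using (toℕ-fromℕ<; toℕ-injective; toℕ<n)
open import Data.Product using (Σ; _×_; _,_; proj₁; proj₂)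
open import Data.Product.Function.Dependent.Propositional using (Σ-↔)
open import Data.Product.Function.NonDependent.Propositional using (_×-↔_)
open import Data.Sum using (inj₁; inj₂)
open import Data.Empty using (⊥-elim)
open import Data.Maybe using (just)
open import Relation.Nullary using (yes; no; ¬_)
open import Relation.Binary.PropositionalEquality
open import Axiom.UniquenessOfIdentityProofs using (module Decidable⇒UIP)
open import Function.Bundles using (_↔_; _⤖_; mk↔ₛ′)
open import Function.Properties.Inverse using (↔-refl; ↔-sym; ↔-trans; ↔⇒⤖)
import Data.List.Sort as Sort
open Sort ≤-decTotalOrder using (sort; sort-↭; sort-↗)

empty↔ : ∀ {A B : Set} → ¬ A → ¬ B → A ↔ B
empty↔ ¬a ¬b = mk↔ₛ′ (λ x → ⊥-elim (¬a x)) (λ y → ⊥-elim (¬b y))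
                     (λ y → ⊥-elim (¬b y)) (λ x → ⊥-elim (¬a x))

suc-injective∘cong-suc : ∀ {m n} (p : m ≡ n) → suc-injective (cong suc p) ≡ p
suc-injective∘cong-suc refl = refl

cong-suc∘suc-injective : ∀ {m n} (p : suc m ≡ suc n) → cong suc (suc-injective p) ≡ p
cong-suc∘suc-injective refl = refl

list-≡-irrelevant : {xs ys : List ℕ} (p q : xs ≡ ys) → p ≡ q
list-≡-irrelevant = Decidable⇒UIP.≡-irrelevant (≡-dec _≟_)

first-occurrence-unique : ∀ {A : Set} {P : A → Set} pre₁ x₁ post₁ pre₂ x₂ post₂ →
  pre₁ ++ x₁ ∷ post₁ ≡ pre₂ ++ x₂ ∷ post₂ → P x₁ → P x₂ →
  All (λ x → ¬ P x) pre₁ → All (λ x → ¬ P x) pre₂ →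
  pre₁ ≡ pre₂ × x₁ ≡ x₂ × post₁ ≡ post₂
first-occurrence-unique [] x₁ post₁ [] x₂ post₂ refl _ _ _ _ = refl , refl , refl
first-occurrence-unique [] x₁ post₁ (y ∷ pre₂) x₂ post₂ refl p₁ _ _ (¬p ∷ _) = ⊥-elim (¬p p₁)
first-occurrence-unique (y ∷ pre₁) x₁ post₁ [] x₂ post₂ refl _ p₂ (¬p ∷ _) _ = ⊥-elim (¬p p₂)
first-occurrence-unique (y₁ ∷ pre₁) x₁ post₁ (y₂ ∷ pre₂) x₂ post₂ eq p₁ p₂ (_ ∷ f₁) (_ ∷ f₂)
  with first-occurrence-unique pre₁ x₁ post₁ pre₂ x₂ post₂ (∷-injectiveʳ eq) p₁ p₂ f₁ f₂
... | pre≡ , x≡ , post≡ = cong₂ _∷_ (∷-injectiveˡ eq) pre≡ , x≡ , post≡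

Cut : Set → Set
Cut A = List A × List A × List A

cut : ∀ {A : Set} → ℕ → ℕ → List A → Cut A
cut i d xs = take i xs , take d (drop i xs) , drop d (drop i xs)

flatten : ∀ {A : Set} → Cut A → List A
flatten (pre , mid , post) = pre ++ mid ++ post

flatten-cut : ∀ {A : Set} i d (xs : List A) → flatten (cut i d xs) ≡ xs
flatten-cut i d xs = begin
  take i xs ++ take d (drop i xs) ++ drop d (drop i xs) ≡⟨ cong (take i xs ++_) (take++drop≡id d (drop i xs)) ⟩
  take i xs ++ drop i xs                                ≡⟨ take++drop≡id i xs ⟩
  xs                                                    ∎
  where open ≡-Reasoning

cut-lengths : ∀ {A : Set} i d (xs : List A) → i + d ≤ length xs →
              length (take i xs) ≡ i × length (take d (drop i xs)) ≡ d
cut-lengths i d xs i+d≤ =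
  trans (length-take i xs) (m≤n⇒m⊓n≡m (m+n≤o⇒m≤o i i+d≤)) ,
  trans (length-take d (drop i xs))
        (m≤n⇒m⊓n≡m (subst (d ≤_) (sym (length-drop i xs))
                          (m+n≤o⇒m≤o∸n d (subst (_≤ length xs) (+-comm i d) i+d≤))))

take-length-++ : ∀ {A : Set} (xs ys : List A) → take (length xs) (xs ++ ys) ≡ xs
take-length-++ []       ys = refl
take-length-++ (x ∷ xs) ys = cong (x ∷_) (take-length-++ xs ys)

drop-length-++ : ∀ {A : Set} (xs ys : List A) → drop (length xs) (xs ++ ys) ≡ ys
drop-length-++ []       ys = refl
drop-length-++ (x ∷ xs) ys = drop-length-++ xs ys

cut-flatten : ∀ {A : Set} (pre mid post : List A) →
              cut (length pre) (length mid) (pre ++ mid ++ post) ≡ (pre , mid , post)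
cut-flatten pre mid post
  rewrite take-length-++ pre (mid ++ post) | drop-length-++ pre (mid ++ post)
        | take-length-++ mid post | drop-length-++ mid post = refl

length-insert : ∀ {A : Set} (pre : List A) x post →
                length (pre ++ x ∷ post) ≡ suc (length pre + length post)
length-insert []        x post = refl
length-insert (_ ∷ pre) x post = cong suc (length-insert pre x post)

length-flatten : ∀ {A : Set} (pre mid post : List A) →
                 length (pre ++ mid ++ post) ≡ (length pre + length post) + length mid
length-flatten []        mid post = trans (length-++ mid) (+-comm (length mid) (length post))
length-flatten (_ ∷ pre) mid post = cong suc (length-flatten pre mid post)

-- Number of slots after replacing one of y+1 slots by d slots (= y + d),
-- defined so that each step kind of a path matches definitionally.
next : ℕ → ℕ → ℕ
next y zero          = y
next y (suc zero)    = suc y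
next y (suc (suc ℓ)) = suc (y + suc ℓ)

next≡+ : ∀ y d → next y d ≡ y + d
next≡+ y zero          = sym (+-identityʳ y)
next≡+ y (suc zero)    = sym (trans (+-suc y 0) (cong suc (+-identityʳ y)))
next≡+ y (suc (suc ℓ)) = sym (+-suc y (suc ℓ))

data Code : ℕ → ℕ → Set where
  leaf : Code 1 0
  grow : ∀ {y k} (d : ℕ) → Fin (suc y) → Code (next y d) k → Code (suc y) (suc k)

grow↔ : ∀ y k → Code (suc y) (suc k) ↔ Σ ℕ (λ d → Fin (suc y) × Code (next y d) k)
grow↔ y k = mk↔ₛ′ (λ { (grow d i w) → d , i , w }) (λ { (d , i , w) → grow d i w })
                  (λ _ → refl) (λ { (grow d i w) → refl })

PathsFrom : ℕ → ℕ → Set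
PathsFrom h k = Σ (List Step) (λ u →
  (length u ≡ k) × (walk h u ≡ just 0) × All (λ v → Fin (pos v)) (labelFrom h u))

prependA : ∀ {h k} ℓ → Fin (suc h) → PathsFrom (h + suc ℓ) k → PathsFrom h (suc k)
prependA ℓ i (u , len , ok , s) = a ℓ ∷ u , cong suc len , ok , i ∷ s

prependB : ∀ {h k} → Fin (suc (suc h)) → PathsFrom h k → PathsFrom (suc h) (suc k)
prependB i (u , len , ok , s) = b ∷ u , cong suc len , ok , i ∷ s

prependC : ∀ {h k} → Fin (suc h) → PathsFrom h k → PathsFrom h (suc k)
prependC i (u , len , ok , s) = c ∷ u , cong suc len , ok , i ∷ s

-- Height h means h+1 slots; a_{ℓ+1}, c, b replace a slot by ℓ+2, 1, 0 slots.
path→code : ∀ {h k} → PathsFrom h k → Code (suc h) k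
path→code ([] , refl , refl , []) = leaf
path→code {k = zero} (_ ∷ _ , () , _)
path→code {k = suc k} (a ℓ ∷ u , len , ok , i ∷ s) =
  grow (suc (suc ℓ)) i (path→code (u , suc-injective len , ok , s))
path→code {zero} {suc k} (b ∷ u , len , () , _)
path→code {suc h} {suc k} (b ∷ u , len , ok , i ∷ s) =
  grow zero i (path→code (u , suc-injective len , ok , s))
path→code {k = suc k} (c ∷ u , len , ok , i ∷ s) =
  grow (suc zero) i (path→code (u , suc-injective len , ok , s))

code→path : ∀ {h k} → Code (suc h) k → PathsFrom h k
code→path leaf                     = [] , refl , refl , []
code→path (grow (suc (suc ℓ)) i w) = prependA ℓ i (code→path w)
code→path (grow (suc zero) i w)    = prependC i (code→path w)
code→path {suc h} (grow zero i w)  = prependB i (code→path w)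
code→path {zero}  (grow zero i ())

-- Decoding a prepended step only re-derives the tail's length proof.
path→code-tail : ∀ {h k} (P : PathsFrom h k) →
  path→code (proj₁ P , suc-injective (cong suc (proj₁ (proj₂ P))) , proj₂ (proj₂ P)) ≡ path→code P
path→code-tail (u , len , rest) = cong (λ p → path→code (u , p , rest)) (suc-injective∘cong-suc len)

path→code∘code→path : ∀ {h k} (w : Code (suc h) k) → path→code (code→path w) ≡ w
path→code∘code→path leaf = refl
path→code∘code→path {zero}  (grow zero i ())
path→code∘code→path {suc h} (grow zero i w) =
  cong (grow zero i) (trans (path→code-tail (code→path w)) (path→code∘code→path w))
path→code∘code→path (grow (suc zero) i w) =
  cong (grow (suc zero) i) (trans (path→code-tail (code→path w)) (path→code∘code→path w))
path→code∘code→path (grow (suc (suc ℓ)) i w) =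
  cong (grow (suc (suc ℓ)) i) (trans (path→code-tail (code→path w)) (path→code∘code→path w))

code→path∘path→code : ∀ {h k} (P : PathsFrom h k) → code→path (path→code P) ≡ P
code→path∘path→code ([] , refl , refl , []) = refl
code→path∘path→code {k = zero} (_ ∷ _ , () , _)
code→path∘path→code {k = suc k} (a ℓ ∷ u , len , ok , i ∷ s) =
  trans (cong (prependA ℓ i) (code→path∘path→code (u , suc-injective len , ok , s)))
        (cong (λ p → a ℓ ∷ u , p , ok , i ∷ s) (cong-suc∘suc-injective len))
code→path∘path→code {zero} {suc k} (b ∷ u , len , () , _)
code→path∘path→code {suc h} {suc k} (b ∷ u , len , ok , i ∷ s) =
  trans (cong (prependB i) (code→path∘path→code (u , suc-injective len , ok , s)))
        (cong (λ p → b ∷ u , p , ok , i ∷ s) (cong-suc∘suc-injective len))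
code→path∘path→code {k = suc k} (c ∷ u , len , ok , i ∷ s) =
  trans (cong (prependC i) (code→path∘path→code (u , suc-injective len , ok , s)))
        (cong (λ p → c ∷ u , p , ok , i ∷ s) (cong-suc∘suc-injective len))

path↔code : ∀ h k → PathsFrom h k ↔ Code (suc h) k
path↔code h k = mk↔ₛ′ path→code code→path path→code∘code→path code→path∘path→code

range : ℕ → ℕ → List ℕ
range j zero    = []
range j (suc k) = j ∷ range (suc j) k

range-sorted : ∀ j k → Sorted (range j k)
range-sorted j zero          = []
range-sorted j (suc zero)    = [-]
range-sorted j (suc (suc k)) = n≤1+n j ∷ range-sorted (suc j) (suc k)

range-lowerBound : ∀ j k → All (j ≤_) (range j k)
range-lowerBound j zero    = []
range-lowerBound j (suc k) = ≤-refl ∷ All.map (≤-trans (n≤1+n j)) (range-lowerBound (suc j) k)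

applyUpTo-range : ∀ (f : ℕ → ℕ) j k → (∀ x → f x ≡ j + x) → applyUpTo f k ≡ range j k
applyUpTo-range f j zero    f≗ = refl
applyUpTo-range f j (suc k) f≗ =
  cong₂ _∷_ (trans (f≗ 0) (+-identityʳ j))
            (applyUpTo-range (λ x → f (suc x)) (suc j) k (λ x → trans (f≗ (suc x)) (+-suc j x)))

sort≡range : ∀ {xs} j k → xs ↭ range j k → sort xs ≡ range j k
sort≡range {xs} j k xs↭ = Pointwise-≡⇒≡
  (Sorted.↗↭↗⇒≋ ≤-totalOrder (sort-↗ xs) (range-sorted j k) (↭⇒↭ₛ (↭-trans (sort-↭ xs) xs↭)))

sort≡⇒↭ : ∀ {xs ys} → sort xs ≡ ys → xs ↭ ys
sort≡⇒↭ {xs} refl = ↭-sym (sort-↭ xs)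

labelsList-++ : ∀ ts us → labelsList (ts ++ us) ≡ labelsList ts ++ labelsList us
labelsList-++ []       us = refl
labelsList-++ (t ∷ ts) us = trans (cong (labels t ++_) (labelsList-++ ts us)) (sym (++-assoc (labels t) _ _))

labelsList-flatten : ∀ pre cs post →
  labelsList (pre ++ cs ++ post) ≡ labelsList pre ++ labelsList cs ++ labelsList post
labelsList-flatten pre cs post = trans (labelsList-++ pre _) (cong (labelsList pre ++_) (labelsList-++ cs post))

labels-graft : ∀ j pre cs post →
  labelsList (pre ++ node j cs ∷ post) ↭ j ∷ labelsList (pre ++ cs ++ post)
labels-graft j pre cs post =
  ↭-trans (↭-reflexive (labelsList-++ pre _))
          (↭-trans (shift j (labelsList pre) (labelsList cs ++ labelsList post))
                   (↭-reflexive (cong (j ∷_) (sym (labelsList-flatten pre cs post)))))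

mutual
  tree-above : ∀ {r t} → r < label t → Increasing t → All (r <_) (labels t)
  tree-above r<k (incr ps) = r<k ∷ All.map (<-trans r<k) (children-above ps)

  children-above : ∀ {k ts} → All (λ t → (k < label t) × Increasing t) ts → All (k <_) (labelsList ts)
  children-above []                = []
  children-above ((k<t , it) ∷ ps) = All.++⁺ (tree-above k<t it) (children-above ps)

roots : ∀ {P : ℕ → Set} ts → All P (labelsList ts) → All (λ t → P (label t)) ts
roots []                 _        = []
roots (node r cs ∷ ts) (p ∷ ps) = p ∷ roots ts (All.++⁻ʳ (labelsList cs) ps)

mutual
  Increasing-irrelevant : ∀ {t} (p q : Increasing t) → p ≡ q
  Increasing-irrelevant (incr ps) (incr qs) = cong incr (children-irrelevant ps qs)

  children-irrelevant : ∀ {k ts} (p q : All (λ t → (k < label t) × Increasing t) ts) → p ≡ q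
  children-irrelevant []             []             = refl
  children-irrelevant ((x , p) ∷ ps) ((y , q) ∷ qs) =
    cong₂ _∷_ (cong₂ _,_ (<-irrelevant x y) (Increasing-irrelevant p q)) (children-irrelevant ps qs)

All-Increasing-irrelevant : ∀ {ts} (p q : All Increasing ts) → p ≡ q
All-Increasing-irrelevant []       []       = refl
All-Increasing-irrelevant (p ∷ ps) (q ∷ qs) = cong₂ _∷_ (Increasing-irrelevant p q) (All-Increasing-irrelevant ps qs)

ungraft-increasing : ∀ {j} pre cs post →
  All Increasing (pre ++ node j cs ∷ post) → All Increasing (pre ++ cs ++ post)
ungraft-increasing pre cs post inc with All.++⁻ pre inc
... | inc-pre , (incr ps ∷ inc-post) = All.++⁺ inc-pre (All.++⁺ (All.map proj₂ ps) inc-post)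

graft-increasing : ∀ {j} pre cs post → All (j <_) (labelsList cs) →
  All Increasing (pre ++ cs ++ post) → All Increasing (pre ++ node j cs ∷ post)
graft-increasing pre cs post above inc =
  All.++⁺ (All.++⁻ˡ pre inc)
          (incr (All.zip (roots cs above , All.++⁻ˡ cs rest)) ∷ All.++⁻ʳ cs rest)
  where
  rest : All Increasing (cs ++ post)
  rest = All.++⁻ʳ pre inc

Forest : ℕ → ℕ → ℕ → Set
Forest q j k = Σ (List PTree) (λ ts →
  (length ts ≡ q) × All Increasing ts × (sort (labelsList ts) ≡ range j k))

forest-≡ : ∀ {q j k} (F G : Forest q j k) → proj₁ F ≡ proj₁ G → F ≡ G
forest-≡ (ts , l , i , s) (.ts , l′ , i′ , s′) refl =
  cong₂ (λ l x → ts , l , x) (≡-irrelevant l l′)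
        (cong₂ _,_ (All-Increasing-irrelevant i i′) (list-≡-irrelevant s s′))

forest-nonempty : ∀ {j k} → ¬ Forest 0 j (suc k)
forest-nonempty ([] , _ , _ , s) with ↭-length (sort≡⇒↭ s)
... | ()

single-label : ∀ {j} ts → labelsList ts ↭ j ∷ [] → ts ≡ node j [] ∷ []
single-label [] p with ↭-length p
... | ()
single-label (node r [] ∷ []) p with ↭-singleton-inv p
... | refl = refl
single-label (node r (node _ _ ∷ _) ∷ _) p with ↭-singleton-inv p
... | ()
single-label (node r [] ∷ node _ _ ∷ _) p with ↭-singleton-inv p
... | ()

forest-size-1 : ∀ {q j} (F : Forest q j 1) → proj₁ F ≡ node j [] ∷ []
forest-size-1 (ts , _ , _ , s) = single-label ts (sort≡⇒↭ s)

record RootAt (j : ℕ) (ts : List PTree) : Set where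
  field
    pre cs post : List PTree
    splits      : ts ≡ pre ++ node j cs ∷ post
    fresh       : All (λ t → label t ≢ j) pre

findRoot : ∀ j ts → All Increasing ts → All (j ≤_) (labelsList ts) → j ∈ labelsList ts → RootAt j ts
findRoot j (node r cs ∷ ts) (incr ps ∷ inc) (j≤r ∷ bound) j∈ with r ≟ j
... | yes refl = record { pre = [] ; cs = cs ; post = ts ; splits = refl ; fresh = [] }
... | no r≢j with j∈
...   | here j≡r = ⊥-elim (r≢j (sym j≡r))
...   | there j∈′ with ∈-++⁻ (labelsList cs) j∈′
...     | inj₁ j∈cs = ⊥-elim (<⇒≱ (All.lookup (children-above ps) j∈cs) j≤r)
...     | inj₂ j∈ts = record
  { pre = node r cs ∷ pre ; cs = cs′ ; post = post
  ; splits = cong (node r cs ∷_) splits ; fresh = r≢j ∷ fresh }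
  where open RootAt (findRoot j ts inc (All.++⁻ʳ (labelsList cs) bound) j∈ts) renaming (cs to cs′)

rootAt-unique : ∀ {j} pre₁ cs₁ post₁ pre₂ cs₂ post₂ →
  pre₁ ++ node j cs₁ ∷ post₁ ≡ pre₂ ++ node j cs₂ ∷ post₂ →
  All (λ t → label t ≢ j) pre₁ → All (λ t → label t ≢ j) pre₂ →
  pre₁ ≡ pre₂ × cs₁ ≡ cs₂ × post₁ ≡ post₂
rootAt-unique {j} pre₁ cs₁ post₁ pre₂ cs₂ post₂ eq f₁ f₂
  with first-occurrence-unique {P = λ t → label t ≡ j} pre₁ _ post₁ pre₂ _ post₂ eq refl refl f₁ f₂
... | pre≡ , refl , post≡ = pre≡ , refl , post≡

-- Forests with one label fewer, recorded with the position and outdegree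
-- of the removed root.
Opened : ℕ → ℕ → ℕ → Set
Opened y j k = Σ ℕ (λ d → Fin (suc y) × Forest (next y d) (suc j) (suc k))

ungraft : ∀ {y j k} pre cs post →
  length (pre ++ node j cs ∷ post) ≡ suc y → All Increasing (pre ++ node j cs ∷ post) →
  labelsList (pre ++ node j cs ∷ post) ↭ j ∷ range (suc j) (suc k) → Opened y j k
ungraft {y} {j} {k} pre cs post len inc labs =
  length cs , fromℕ< pre<
  , (pre ++ cs ++ post , len′ , ungraft-increasing pre cs post inc
    , sort≡range (suc j) (suc k) (drop-∷ (↭-trans (↭-sym (labels-graft j pre cs post)) labs)))
  where
  pre+post≡y : length pre + length post ≡ y
  pre+post≡y = suc-injective (trans (sym (length-insert pre _ post)) len)
  pre< : length pre < suc y
  pre< = s≤s (subst (length pre ≤_) pre+post≡y (m≤m+n (length pre) (length post)))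
  len′ : length (pre ++ cs ++ post) ≡ next y (length cs)
  len′ = trans (length-flatten pre cs post)
               (trans (cong (_+ length cs) pre+post≡y) (sym (next≡+ y (length cs))))

rootOf : ∀ {y j k} (F : Forest (suc y) j (suc (suc k))) → RootAt j (proj₁ F)
rootOf {j = j} {k} (ts , _ , inc , s) =
  findRoot j ts inc (All-resp-↭ (↭-sym labs) (range-lowerBound j (suc (suc k))))
                    (∈-resp-↭ (↭-sym labs) (here refl))
  where
  labs : labelsList ts ↭ range j (suc (suc k))
  labs = sort≡⇒↭ s

removeMin : ∀ {y j k} → Forest (suc y) j (suc (suc k)) → Opened y j k
removeMin {y} {j} {k} F@(ts , len , inc , s) =
  ungraft pre cs post (subst (λ ts → length ts ≡ suc y) splits len)
    (subst (All Increasing) splits inc) (subst (λ ts → labelsList ts ↭ _) splits (sort≡⇒↭ s))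
  where open RootAt (rootOf F)

graft : ℕ → Cut PTree → List PTree
graft j (pre , cs , post) = pre ++ node j cs ∷ post

module Insert {y j k : ℕ} (d : ℕ) (i : Fin (suc y)) (F : Forest (next y d) (suc j) (suc k)) where
  L : List PTree
  L = proj₁ F

  pieces : Cut PTree
  pieces = cut (toℕ i) d L

  pre cs post : List PTree
  pre  = proj₁ pieces
  cs   = proj₁ (proj₂ pieces)
  post = proj₂ (proj₂ pieces)

  L≡ : L ≡ pre ++ cs ++ post
  L≡ = sym (flatten-cut (toℕ i) d L)

  labels-above : All (suc j ≤_) (labelsList pre ++ labelsList cs ++ labelsList post)
  labels-above = subst (All (suc j ≤_)) (trans (cong labelsList L≡) (labelsList-flatten pre cs post))
    (All-resp-↭ (↭-sym (sort≡⇒↭ (proj₂ (proj₂ (proj₂ F))))) (range-lowerBound (suc j) (suc k)))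

  lengths : length pre ≡ toℕ i × length cs ≡ d
  lengths = cut-lengths (toℕ i) d L
    (subst (toℕ i + d ≤_) (sym (trans (proj₁ (proj₂ F)) (next≡+ y d)))
           (+-monoˡ-≤ d (≤-pred (toℕ<n i))))

  fresh : All (λ t → label t ≢ j) pre
  fresh = All.map (λ j<t t≡j → <⇒≢ j<t (sym t≡j)) (roots pre (All.++⁻ˡ (labelsList pre) labels-above))

  result : Forest (suc y) j (suc (suc k))
  result = pre ++ node j cs ∷ post , len , inc , sort≡range j (suc (suc k)) labs
    where
    len : length (pre ++ node j cs ∷ post) ≡ suc y
    len = trans (length-insert pre _ post) (cong suc (+-cancelʳ-≡ _ _ _
      (begin
        (length pre + length post) + d ≡⟨ cong ((length pre + length post) +_) (sym (proj₂ lengths)) ⟩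
        (length pre + length post) + length cs ≡⟨ sym (length-flatten pre cs post) ⟩
        length (pre ++ cs ++ post) ≡⟨ cong length (sym L≡) ⟩
        length L ≡⟨ trans (proj₁ (proj₂ F)) (next≡+ y d) ⟩
        y + d ∎)))
      where open ≡-Reasoning
    inc : All Increasing (pre ++ node j cs ∷ post)
    inc = graft-increasing pre cs post
            (All.++⁻ˡ (labelsList cs) (All.++⁻ʳ (labelsList pre) labels-above))
            (subst (All Increasing) L≡ (proj₁ (proj₂ (proj₂ F))))
    labs : labelsList (pre ++ node j cs ∷ post) ↭ range j (suc (suc k))
    labs = ↭-trans (labels-graft j pre cs post)
                   (↭-prep j (subst (λ ts → labelsList ts ↭ _) L≡ (sort≡⇒↭ (proj₂ (proj₂ (proj₂ F))))))

insertMin : ∀ {y j k} → Opened y j k → Forest (suc y) j (suc (suc k))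
insertMin (d , i , F) = Insert.result d i F

-- Inserting after removing: cutting pre ++ cs ++ post at |pre|, |cs| gives back
-- the decomposition.
insertMin∘removeMin : ∀ {y j k} (F : Forest (suc y) j (suc (suc k))) → insertMin (removeMin F) ≡ F
insertMin∘removeMin {y} {j} F = forest-≡ _ F (begin
  graft j (cut (toℕ i) (length cs) (pre ++ cs ++ post))      ≡⟨ cong (λ n → graft j (cut n (length cs) (pre ++ cs ++ post))) (toℕ-fromℕ< _) ⟩
  graft j (cut (length pre) (length cs) (pre ++ cs ++ post)) ≡⟨ cong (graft j) (cut-flatten pre cs post) ⟩
  pre ++ node j cs ∷ post                                     ≡⟨ sym splits ⟩
  proj₁ F                                                     ∎)
  where
  open RootAt (rootOf F)
  open ≡-Reasoning
  i : Fin (suc y)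
  i = proj₁ (proj₂ (removeMin F))

opened-≡ : ∀ {y j k d d′} {i i′ : Fin (suc y)}
  (F : Forest (next y d) (suc j) (suc k)) (F′ : Forest (next y d′) (suc j) (suc k)) →
  d ≡ d′ → toℕ i ≡ toℕ i′ → proj₁ F ≡ proj₁ F′ → _≡_ {A = Opened y j k} (d , i , F) (d′ , i′ , F′)
opened-≡ F F′ refl i≡ ts≡ = cong₂ (λ i F → _ , i , F) (toℕ-injective i≡) (forest-≡ F F′ ts≡)

-- Removing after inserting: the inserted root is the first root labelled j,
-- so the decomposition found is the cut.
removeMin∘insertMin : ∀ {y j k} (X : Opened y j k) → removeMin (insertMin X) ≡ X
removeMin∘insertMin (d , i , F) =
  opened-≡ _ F (trans (cong length cs≡) (proj₂ lengths))
               (trans (toℕ-fromℕ< _) (trans (cong length pre≡) (proj₁ lengths)))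
               (trans (cong₂ _++_ pre≡ (cong₂ _++_ cs≡ post≡)) (sym L≡))
  where
  open Insert d i F
  open RootAt (rootOf result) renaming (pre to pre′; cs to cs′; post to post′; fresh to fresh′)
  same : pre′ ≡ pre × cs′ ≡ cs × post′ ≡ post
  same = rootAt-unique pre′ cs′ post′ pre cs post (sym splits) fresh′ fresh
  pre≡ : pre′ ≡ pre
  pre≡ = proj₁ same
  cs≡ : cs′ ≡ cs
  cs≡ = proj₁ (proj₂ same)
  post≡ : post′ ≡ post
  post≡ = proj₂ (proj₂ same)

removeMin↔ : ∀ y j k → Forest (suc y) j (suc (suc k)) ↔ Opened y j k
removeMin↔ y j k =
  mk↔ₛ′ (removeMin {y} {j} {k}) insertMin (removeMin∘insertMin {y} {j} {k}) insertMin∘removeMin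

forest↔code : ∀ k q j → Forest q j (suc k) ↔ Code q k
forest↔code zero zero j = empty↔ forest-nonempty (λ ())
forest↔code zero (suc zero) j =
  mk↔ₛ′ (λ _ → leaf) (λ _ → node j [] ∷ [] , refl , incr [] ∷ [] , sort≡range {xs = j ∷ []} j 1 ↭-refl)
        (λ { leaf → refl }) (λ F → forest-≡ _ F (sym (forest-size-1 F)))
forest↔code zero (suc (suc y)) j =
  empty↔ (λ F → 1+n≢0 (suc-injective (trans (sym (proj₁ (proj₂ F))) (cong length (forest-size-1 F)))))
         (λ ())
forest↔code (suc k) zero j = empty↔ forest-nonempty (λ ())
forest↔code (suc k) (suc y) j =
  ↔-trans (removeMin↔ y j k)
    (↔-trans (Σ-↔ ↔-refl (↔-refl ×-↔ forest↔code k _ (suc j)))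
             (↔-sym (grow↔ y k)))

incTree↔forest : ∀ n → IncTree (suc n) ↔ Forest 1 1 (suc n)
incTree↔forest n = mk↔ₛ′ to from to∘from from∘to
  where
  labels≡ : ∀ t → sort (labelsList (t ∷ [])) ≡ sort (labels t)
  labels≡ t = cong sort (++-identityʳ (labels t))
  upTo≡ : applyUpTo suc (suc n) ≡ range 1 (suc n)
  upTo≡ = applyUpTo-range suc 1 (suc n) (λ _ → refl)
  to : IncTree (suc n) → Forest 1 1 (suc n)
  to (t , inc , s) = t ∷ [] , refl , inc ∷ [] , trans (labels≡ t) (trans s upTo≡)
  from : Forest 1 1 (suc n) → IncTree (suc n)
  from (t ∷ [] , _ , inc ∷ [] , s) = t , inc , trans (sym (labels≡ t)) (trans s (sym upTo≡))
  to∘from : ∀ F → to (from F) ≡ F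
  to∘from F@(_ ∷ [] , _ , _ ∷ [] , _) = forest-≡ _ F refl
  from∘to : ∀ T → from (to T) ≡ T
  from∘to (t , inc , s) = cong (λ s → t , inc , s) (list-≡-irrelevant _ _)

theorem6 : (n : ℕ) → IncTree (suc n) ⤖ PathDiagram n
theorem6 n = ↔⇒⤖ (↔-trans (incTree↔forest n) (↔-trans (forest↔code n 1 1) (↔-sym (path↔code 0 n))))
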